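{- Let $p,q$ be primes with $2<p<q$, and let $g$, $g_0$, $g_2$, $\kappa$, $\lambda$ be as in the context. Then: (i) $g_2\le g\le g_0$; (ii) $g=g_0$ if and only if $\kappa+\lambda\ge p$; (iii) $g=g_2$ if $p=3$ or if $(p,q)$ is a twin prime pair (i.e. $q=p+2$).
   Context: Let $p,q$ be primes with $2<p<q$, and put $p'=(p-1)/2$, $q'=(q-1)/2$. Set $d_0=pq$, $d_1=p'q$, $d_2=pq'$, $d_3=(pq-1)/2$ (these have greatest common divisor $1$), and for integers $x,y,z,w$ put $f(x,y,z,w)=xd_0+yd_1+zd_2+wd_3$. A positive integer $n$ is called representable if $n=f(x,y,z,w)$ for some nonnegative integers $x,y,z,w$. The Frobenius number $g$ is the largest positive integer that is not representable. Define integers $\kappa,\lambda$ by $q=\kappa p+\lambda$ with $1\le\lambda\le p-1$. Put $g_0=f(p'-1,p-1,\kappa,-1)$ and $g_2=g_0-(p-3)d_3$. -}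

module Defs where

open import Data.Nat as ℕ using (ℕ; _∸_; _/_; _<_)
open import Data.Integer as ℤ using (ℤ; +_; -_)
open import Data.Product using (∃-syntax; _×_)
open import Relation.Nullary using (¬_)
open import Relation.Binary.PropositionalEquality using (_≡_)

half-1 : ℕ → ℕ
half-1 n = (n ∸ 1) / 2

d0 d1 d2 d3 : ℕ → ℕ → ℕ
d0 p q = p ℕ.* q
d1 p q = half-1 p ℕ.* q
d2 p q = p ℕ.* half-1 q
d3 p q = ((p ℕ.* q) ∸ 1) / 2

f : ℕ → ℕ → ℤ → ℤ → ℤ → ℤ → ℤ
f p q x y z w =
  x ℤ.* + d0 p q ℤ.+ y ℤ.* + d1 p q ℤ.+ z ℤ.* + d2 p q ℤ.+ w ℤ.* + d3 p q

Representable : ℕ → ℕ → ℕ → Set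
Representable p q n = ∃[ x ] ∃[ y ] ∃[ z ] ∃[ w ]
  (n ≡ x ℕ.* d0 p q ℕ.+ y ℕ.* d1 p q ℕ.+ z ℕ.* d2 p q ℕ.+ w ℕ.* d3 p q)

IsFrobenius : ℕ → ℕ → ℕ → Set
IsFrobenius p q g =
  (0 < g) × ¬ Representable p q g × (∀ n → g < n → Representable p q n)

g₀ : ℕ → ℕ → ℕ → ℤ
g₀ p q κ = f p q (+ half-1 p ℤ.- + 1) (+ p ℤ.- + 1) (+ κ) (- + 1)

g₂ : ℕ → ℕ → ℕ → ℤ
g₂ p q κ = g₀ p q κ ℤ.- (+ p ℤ.- + 3) ℤ.* + d3 p q

{-# OPTIONS --safe #-}
-- Write p = 2a + 1, q = 2b + 1 and D = (pq − 1)/2 = 2ab + a + b; the generators are 2D + 1, D − b,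
-- D − a and D. Hence n is representable as soon as n + yb + za = sD + x with 2x + y + z ≤ s, and a
-- case analysis on the deficit sD − n shows that every integer above g₀ is representable, and for
-- twin primes every integer above g₂. Conversely a representation of n doubles to
-- 2n + yq + zp + w = s pq with y + z + w ≤ s; for n = g₂, and for n = g₀ when κ + λ ≥ p, reading
-- this modulo pq and then modulo q forces y + z + w > s. When κ + λ < p, g₀ has an explicit
-- representation, and for p = 3 the two bounds coincide.
module Submission where

open import Defs
open import Data.Nat using (ℕ; _+_; _*_; _∸_; _≤_; _<_; _≥_)
open import Data.Nat.Primality using (Prime)
open import Data.Integer using (+_) renaming (_≤_ to _≤ℤ_)
open import Data.Product using (_×_)
open import Data.Sum using (_⊎_)
open import Function.Bundles using (_⇔_)
open import Relation.Binary.PropositionalEquality using (_≡_)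

open import Data.Nat using (zero; suc; z≤n; s≤s; s≤s⁻¹; z<s; _≰_; NonZero; _/_; _%_; _≤?_; _<?_; >-nonZero)
open import Data.Nat.Properties
open import Data.Nat.DivMod using (m≡m%n+[m/n]*n; m%n<n; m*n/n≡m)
open import Data.Nat.Divisibility using (divides)
open import Data.Nat.Primality using (prime⇒irreducible)
open import Data.Nat.Tactic.RingSolver using (solve-∀)
import Data.Integer as ℤ
import Data.Integer.Properties as ℤ
open import Data.Product using (∃-syntax; _,_; proj₁; proj₂)
open import Data.Sum using (inj₁; inj₂; [_,_]′)
open import Data.Empty using (⊥-elim)
open import Function.Base using (id; _∘_)
open import Function.Bundles using (mk⇔; Equivalence)
open import Relation.Nullary using (¬_; Dec; yes; no)
open import Relation.Binary.PropositionalEquality using (refl; sym; trans; cong; cong₂; subst; module ≡-Reasoning)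

m+k≡n⇒m≤n : ∀ {m n} k → m + k ≡ n → m ≤ n
m+k≡n⇒m≤n {m} k refl = m≤m+n m k

-- Representations for odd p and q

D : ℕ → ℕ → ℕ
D a b = 2 * a * b + a + b

Rep : ℕ → ℕ → ℕ → Set
Rep a b n = ∃[ x ] ∃[ y ] ∃[ z ] ∃[ w ]
  n ≡ x * (suc (2 * a) * suc (2 * b)) + y * (a * suc (2 * b)) + z * (suc (2 * a) * b) + w * D a b

half-1-odd : ∀ a → half-1 (suc (2 * a)) ≡ a
half-1-odd a = trans (cong (_/ 2) (*-comm 2 a)) (m*n/n≡m a 2)

d3-odd : ∀ a b → d3 (suc (2 * a)) (suc (2 * b)) ≡ D a b
d3-odd a b = trans (cong (_/ 2) (twice-D a b)) (m*n/n≡m (D a b) 2)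
  where
  twice-D : ∀ a b → 2 * b + 2 * a * suc (2 * b) ≡ (2 * a * b + a + b) * 2
  twice-D = solve-∀

generators-odd : ∀ a b x y z w → let P = suc (2 * a) ; Q = suc (2 * b) in
  x * d0 P Q + y * d1 P Q + z * d2 P Q + w * d3 P Q
    ≡ x * (P * Q) + y * (a * Q) + z * (P * b) + w * D a b
generators-odd a b x y z w =
  trans (cong₂ (λ h k → x * (P * Q) + y * (h * Q) + z * (P * k) + w * d3 P Q) (half-1-odd a) (half-1-odd b))
        (cong (λ d → x * (P * Q) + y * (a * Q) + z * (P * b) + w * d) (d3-odd a b))
  where
  P = suc (2 * a)
  Q = suc (2 * b)

Representable⇔Rep : ∀ a b n → Representable (suc (2 * a)) (suc (2 * b)) n ⇔ Rep a b n
Representable⇔Rep a b n = mk⇔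
  (λ (x , y , z , w , eq) → x , y , z , w , trans eq (generators-odd a b x y z w))
  (λ (x , y , z , w , eq) → x , y , z , w , trans eq (sym (generators-odd a b x y z w)))

-- The generators are 2D + 1, D − b, D − a and D, so that
-- x d₀ + y d₁ + z d₂ + w d₃ = (2x + y + z + w) D + x − y b − z a.
Rep-criterion : ∀ a b s n x y z → y * b + z * a + n ≡ s * D a b + x → 2 * x + y + z ≤ s → Rep a b n
Rep-criterion a b s n x y z eq budget with m≤n⇒∃[o]m+o≡n budget
... | w , refl = x , y , z , w , +-cancelˡ-≡ (y * b + z * a) n _ (trans eq (generator-sum a b x y z w))
  where
  generator-sum : ∀ a b x y z w →
    (2 * x + y + z + w) * (2 * a * b + a + b) + x
      ≡ y * b + z * a
        + (x * (suc (2 * a) * suc (2 * b)) + y * (a * suc (2 * b)) + z * (suc (2 * a) * b) + w * (2 * a * b + a + b))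
  generator-sum = solve-∀

Rep-+multiple : ∀ a b n k → Rep a b n → Rep a b (n + k * D a b)
Rep-+multiple a b n k (x , y , z , w , refl) = x , y , z , w + k , shift _ w k (D a b)
  where
  shift : ∀ X w k D → X + w * D + k * D ≡ X + (w + k) * D
  shift = solve-∀

Rep-beyond : ∀ a b G → 0 < D a b → (∀ r → r < D a b → Rep a b (suc G + r)) → ∀ n → G < n → Rep a b n
Rep-beyond a b G D>0 window n G<n with m≤n⇒∃[o]m+o≡n G<n
... | m , refl = subst (Rep a b) G+m (Rep-+multiple a b _ (m / D a b) (window (m % D a b) (m%n<n m (D a b))))
  where
  instance _ = >-nonZero D>0
  G+m : suc G + m % D a b + m / D a b * D a b ≡ suc G + m
  G+m = trans (+-assoc (suc G) _ _) (cong (λ m → suc G + m) (sym (m≡m%n+[m/n]*n m (D a b))))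

-- Non-representability of g₂ and g₀

-- Since 2D = pq − 1, 2d₁ = pq − q and 2d₂ = pq − p.
Rep⇒double : ∀ a b n → Rep a b n → ∃[ s ] ∃[ y ] ∃[ z ] ∃[ w ]
  2 * n + y * suc (2 * b) + z * suc (2 * a) + w ≡ s * (suc (2 * a) * suc (2 * b)) × y + z + w ≤ s
Rep⇒double a b n (x , y , z , w , refl) = 2 * x + y + z + w , y , z , w , doubled-sum a b x y z w ,
  +-monoˡ-≤ w (+-monoˡ-≤ z (m≤n+m y (2 * x)))
  where
  doubled-sum : ∀ a b x y z w →
    2 * (x * (suc (2 * a) * suc (2 * b)) + y * (a * suc (2 * b)) + z * (suc (2 * a) * b) + w * (2 * a * b + a + b))
      + y * suc (2 * b) + z * suc (2 * a) + w
    ≡ (2 * x + y + z + w) * (suc (2 * a) * suc (2 * b))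
  doubled-sum = solve-∀

split-multiple : ∀ A M K s → 0 < K → A * M + K ≡ s * M → ∃[ t ] s ≡ suc A + t × K ≡ suc t * M
split-multiple A M K s K>0 eq with A <? s
... | no A≮s = ⊥-elim (<⇒≱ (m<m+n (A * M) K>0) (subst (_≤ A * M) (sym eq) (*-monoˡ-≤ M (≮⇒≥ A≮s))))
... | yes A<s with m≤n⇒∃[o]m+o≡n A<s
...   | t , refl = t , refl , +-cancelˡ-≡ (A * M) K _ (trans eq (expand A t M))
  where
  expand : ∀ A t M → (suc A + t) * M ≡ A * M + suc t * M
  expand = solve-∀

-- Reading the equation modulo pq, then modulo q.
PQ-split : ∀ P Q S r s y z w → S * (P * Q) + (suc r + (y * Q + z * P + w)) ≡ s * (P * Q) →
  ∃[ t ] ∃[ c ] s ≡ suc S + t × suc t * P ≡ suc y + c × suc r + (z * P + w) ≡ suc c * Q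
PQ-split P Q S r s y z w eq with split-multiple S (P * Q) _ s z<s eq
... | t , s≡ , rest≡ with split-multiple y Q (suc r + (z * P + w)) (suc t * P) z<s rest≡′
  where
  rest≡′ : y * Q + (suc r + (z * P + w)) ≡ suc t * P * Q
  rest≡′ = trans (regroup r y Q (z * P) w) (trans rest≡ (sym (*-assoc (suc t) P Q)))
    where
    regroup : ∀ r y Q zP w → y * Q + (suc r + (zP + w)) ≡ suc r + (y * Q + zP + w)
    regroup = solve-∀
... | c , tP≡ , zw≡ = t , c , s≡ , tP≡ , zw≡

Rep-double-split : ∀ a b n S r → let P = suc (2 * a) ; Q = suc (2 * b) in
  2 * n ≡ S * (P * Q) + suc r → Rep a b n →
  ∃[ t ] ∃[ c ] ∃[ y ] ∃[ z ] ∃[ w ]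
    y + z + w ≤ suc S + t × suc t * P ≡ suc y + c × suc r + (z * P + w) ≡ suc c * Q
Rep-double-split a b n S r 2n≡ rep =
  let s , y , z , w , eq , budget = Rep⇒double a b n rep
      eq′ = trans (cong (λ m → m + y * Q + z * P + w) (sym 2n≡)) eq
      t , c , s≡ , tP≡ , zw≡ = PQ-split P Q S r s y z w (trans (regroup (S * (P * Q)) r (y * Q) (z * P) w) eq′)
  in t , c , y , z , w , subst (y + z + w ≤_) s≡ budget , tP≡ , zw≡
  where
  P = suc (2 * a)
  Q = suc (2 * b)
  regroup : ∀ X r yQ zP w → X + (suc r + (yQ + zP + w)) ≡ X + suc r + yQ + zP + w
  regroup = solve-∀

digits-bound : ∀ P κ λ′ r c z w → .{{NonZero P}} → suc (suc r) ≤ P + λ′ →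
  suc r + (z * P + w) ≡ suc c * (κ * P + λ′) → suc c * κ ≤ z + w
digits-bound P κ λ′ r c z w r+2≤ eq with suc c * κ ≤? z + w
... | yes enough = enough
... | no short = ⊥-elim (<-irrefl refl (begin-strict
    K + λ′ + P                   ≤⟨ +-monoˡ-≤ P (+-monoʳ-≤ K (m≤n*m λ′ (suc c))) ⟩
    K + suc c * λ′ + P           ≡⟨ cong (_+ P) (sym (spread c κ P λ′)) ⟩
    suc c * (κ * P + λ′) + P     ≡⟨ cong (_+ P) (sym eq) ⟩
    suc r + (z * P + w) + P      ≤⟨ +-monoˡ-≤ P (+-monoʳ-≤ (suc r) (+-monoʳ-≤ (z * P) (m≤m*n w P))) ⟩
    suc r + (z * P + w * P) + P  ≡⟨ collect r z w P ⟩
    suc r + suc (z + w) * P      ≤⟨ +-monoʳ-≤ (suc r) (*-monoˡ-≤ P (≰⇒> short)) ⟩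
    suc r + K                    <⟨ +-monoˡ-≤ K r+2≤ ⟩
    P + λ′ + K                   ≡⟨ rotate P λ′ K ⟩
    K + λ′ + P                   ∎))
  where
  open ≤-Reasoning
  K = suc c * κ * P
  spread : ∀ c κ P λ′ → suc c * (κ * P + λ′) ≡ suc c * κ * P + suc c * λ′
  spread = solve-∀
  collect : ∀ r z w P → suc r + (z * P + w * P) + P ≡ suc r + suc (z + w) * P
  collect = solve-∀
  rotate : ∀ P λ′ K → P + λ′ + K ≡ K + λ′ + P
  rotate = solve-∀

digits-bound-overflow : ∀ A κ′ λ′ c i w → A ≤ κ′ + λ′ → λ′ ≤ A →
  suc λ′ + ((suc c * suc κ′ + i) * suc A + w) ≡ suc c * (suc κ′ * suc A + λ′) →
  c + κ′ + A ≤ suc c * suc κ′ + i + w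
digits-bound-overflow A κ′ λ′ c i w A≤κ+λ λ≤A eq = +-cancelʳ-≤ (i * suc A + 1) _ _ (begin
  c + κ′ + A + (i * suc A + 1)  ≡⟨ regroup c κ′ A i ⟩
  c + κ′ + suc i + suc i * A    ≤⟨ +-monoʳ-≤ (c + κ′ + suc i) (*-monoˡ-≤ A i<c) ⟩
  c + κ′ + suc i + c * A        ≤⟨ +-monoʳ-≤ (c + κ′ + suc i) (*-monoʳ-≤ c A≤κ+λ) ⟩
  c + κ′ + suc i + c * (κ′ + λ′) ≡⟨ expand c κ′ λ′ i ⟩
  X + i + c * λ′                ≡⟨ cong (λ m → X + i + m) (sym iP+w) ⟩
  X + i + (i * suc A + suc w)    ≡⟨ shuffle X i w (i * suc A) ⟩
  X + i + w + (i * suc A + 1)   ∎)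
  where
  open ≤-Reasoning
  X = suc c * suc κ′
  split-left : ∀ λ′ X i P w → suc λ′ + ((X + i) * P + w) ≡ X * P + λ′ + (i * P + suc w)
  split-left = solve-∀
  split-right : ∀ c K P λ′ → suc c * (K * P + λ′) ≡ suc c * K * P + λ′ + c * λ′
  split-right = solve-∀
  iP+w : i * suc A + suc w ≡ c * λ′
  iP+w = +-cancelˡ-≡ (X * suc A + λ′) _ _
    (trans (sym (split-left λ′ X i (suc A) w)) (trans eq (split-right c (suc κ′) (suc A) λ′)))
  i<c : i < c
  i<c = *-cancelʳ-< (suc A) i c (begin-strict
    i * suc A             <⟨ m<m+n (i * suc A) z<s ⟩
    i * suc A + suc w     ≡⟨ iP+w ⟩
    c * λ′                ≤⟨ *-monoʳ-≤ c λ≤A ⟩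
    c * A                 ≤⟨ *-monoʳ-≤ c (n≤1+n A) ⟩
    c * suc A             ∎)
  regroup : ∀ c κ′ A i → c + κ′ + A + (i * suc A + 1) ≡ c + κ′ + suc i + suc i * A
  regroup = solve-∀
  expand : ∀ c κ′ λ′ i → c + κ′ + suc i + c * (κ′ + λ′) ≡ suc c * suc κ′ + i + c * λ′
  expand = solve-∀
  shuffle : ∀ X i w iP → X + i + (iP + suc w) ≡ X + i + w + (iP + 1)
  shuffle = solve-∀

digits-bound-underflow : ∀ A κ′ λ′ c z d w → suc z + d ≡ suc c * suc κ′ →
  suc λ′ + (z * suc A + w) ≡ suc c * (suc κ′ * suc A + λ′) → c + κ′ + A ≤ z + w
digits-bound-underflow A κ′ λ′ c z d w zd≡ eq = m+k≡n⇒m≤n (c * κ′ + d * A + c * λ′) (suc-injective (begin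
  suc (c + κ′ + A + (c * κ′ + d * A + c * λ′)) ≡⟨ expand c κ′ A d λ′ ⟩
  suc c * suc κ′ + (A + d * A + c * λ′)       ≡⟨ cong (λ m → m + (A + d * A + c * λ′)) (sym zd≡) ⟩
  suc z + d + (A + d * A + c * λ′)            ≡⟨ regroup z d A c λ′ ⟩
  suc (z + (A + d * suc A + c * λ′))          ≡⟨ cong (λ m → suc (z + m)) (sym w≡) ⟩
  suc (z + w)                                 ∎))
  where
  open ≡-Reasoning
  expand : ∀ c κ′ A d λ′ →
    suc (c + κ′ + A + (c * κ′ + d * A + c * λ′)) ≡ suc c * suc κ′ + (A + d * A + c * λ′)
  expand = solve-∀
  regroup : ∀ z d A c λ′ → suc z + d + (A + d * A + c * λ′) ≡ suc (z + (A + d * suc A + c * λ′))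
  regroup = solve-∀
  spread : ∀ c κ′ A λ′ → suc c * (suc κ′ * suc A + λ′) ≡ suc c * suc κ′ * suc A + suc c * λ′
  spread = solve-∀
  split-right : ∀ z d A c λ′ →
    (suc z + d) * suc A + suc c * λ′ ≡ suc λ′ + (z * suc A + (A + d * suc A + c * λ′))
  split-right = solve-∀
  w≡ : w ≡ A + d * suc A + c * λ′
  w≡ = +-cancelˡ-≡ (z * suc A) _ _ (+-cancelˡ-≡ (suc λ′) _ _ (begin
    suc λ′ + (z * suc A + w)                         ≡⟨ eq ⟩
    suc c * (suc κ′ * suc A + λ′)                    ≡⟨ spread c κ′ A λ′ ⟩
    suc c * suc κ′ * suc A + suc c * λ′              ≡⟨ cong (λ m → m * suc A + suc c * λ′) (sym zd≡) ⟩
    (suc z + d) * suc A + suc c * λ′                 ≡⟨ split-right z d A c λ′ ⟩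
    suc λ′ + (z * suc A + (A + d * suc A + c * λ′))  ∎))

-- Here p = A + 1 and κ = κ′ + 1: the hypotheses say p ≤ κ + λ and λ < p.
digits-bound-large : ∀ A κ′ λ′ c z w → A ≤ κ′ + λ′ → λ′ ≤ A →
  suc λ′ + (z * suc A + w) ≡ suc c * (suc κ′ * suc A + λ′) → c + κ′ + A ≤ z + w
digits-bound-large A κ′ λ′ c z w A≤κ+λ λ≤A eq with suc c * suc κ′ ≤? z
... | no few = digits-bound-underflow A κ′ λ′ c z _ w (proj₂ (m≤n⇒∃[o]m+o≡n (≰⇒> few))) eq
... | yes many with m≤n⇒∃[o]m+o≡n many
...   | i , refl = digits-bound-overflow A κ′ λ′ c i w A≤κ+λ λ≤A eq

Q-decomposition : ∀ a κ e λ′ → κ + λ′ ≡ suc (2 * e) → suc (2 * (κ * a + e)) ≡ κ * suc (2 * a) + λ′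
Q-decomposition a κ e λ′ κ+λ =
  sym (trans (expand κ a λ′) (trans (cong (λ m → 2 * (κ * a) + m) κ+λ) (collect κ a e)))
  where
  expand : ∀ κ a λ′ → κ * suc (2 * a) + λ′ ≡ 2 * (κ * a) + (κ + λ′)
  expand = solve-∀
  collect : ∀ κ a e → 2 * (κ * a) + suc (2 * e) ≡ suc (2 * (κ * a + e))
  collect = solve-∀

-- p = 2a + 1 with a = a′ + 1 and q = κ p + λ with κ = κ′ + 1; then q = 2b + 1 with b = κ a + e,
-- where κ + λ = 2e + 1, and G₀, G₂ are the values of g₀, g₂.
B : ℕ → ℕ → ℕ → ℕ
B a′ κ′ e = suc κ′ * suc a′ + e

G₀ G₂ : ℕ → ℕ → ℕ → ℕ
G₀ a′ κ′ e = (4 * a′ + κ′ + 1) * D (suc a′) (B a′ κ′ e) + (2 * a′ + 1 + e)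
G₂ a′ κ′ e = (2 * a′ + κ′ + 1) * D (suc a′) (B a′ κ′ e) + (2 * a′ + 1 + e)

double-G₂ : ∀ a′ κ′ e λ′ → suc κ′ + λ′ ≡ suc (2 * e) →
  2 * G₂ a′ κ′ e ≡ (2 * a′ + κ′ + 1) * (suc (2 * suc a′) * suc (2 * B a′ κ′ e)) + suc (λ′ + 2 * a′)
double-G₂ a′ κ′ e λ′ κ+λ = +-cancelʳ-≡ (suc κ′) _ _
  (trans (doubled a′ κ′ e)
    (trans (cong (λ m → S * PQ + (2 * a′ + 1 + m)) (sym κ+λ)) (regroup (S * PQ) a′ κ′ λ′)))
  where
  S = 2 * a′ + κ′ + 1
  PQ = suc (2 * suc a′) * suc (2 * B a′ κ′ e)
  doubled : ∀ a′ κ′ e → let a = suc a′ ; b = suc κ′ * a + e in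
    2 * ((2 * a′ + κ′ + 1) * (2 * a * b + a + b) + (2 * a′ + 1 + e)) + suc κ′
      ≡ (2 * a′ + κ′ + 1) * (suc (2 * a) * suc (2 * b)) + (2 * a′ + 1 + suc (2 * e))
  doubled = solve-∀
  regroup : ∀ X a′ κ′ λ′ → X + (2 * a′ + 1 + (suc κ′ + λ′)) ≡ X + suc (λ′ + 2 * a′) + suc κ′
  regroup = solve-∀

double-G₀ : ∀ a′ κ′ e λ′ → suc κ′ + λ′ ≡ suc (2 * e) →
  2 * G₀ a′ κ′ e ≡ (4 * a′ + κ′ + 1) * (suc (2 * suc a′) * suc (2 * B a′ κ′ e)) + suc λ′
double-G₀ a′ κ′ e λ′ κ+λ = +-cancelʳ-≡ (suc κ′) _ _
  (trans (doubled a′ κ′ e) (trans (cong (λ m → S * PQ + (1 + m)) (sym κ+λ)) (regroup (S * PQ) κ′ λ′)))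
  where
  S = 4 * a′ + κ′ + 1
  PQ = suc (2 * suc a′) * suc (2 * B a′ κ′ e)
  doubled : ∀ a′ κ′ e → let a = suc a′ ; b = suc κ′ * a + e in
    2 * ((4 * a′ + κ′ + 1) * (2 * a * b + a + b) + (2 * a′ + 1 + e)) + suc κ′
      ≡ (4 * a′ + κ′ + 1) * (suc (2 * a) * suc (2 * b)) + (1 + suc (2 * e))
  doubled = solve-∀
  regroup : ∀ X κ′ λ′ → X + (1 + (suc κ′ + λ′)) ≡ X + suc λ′ + suc κ′
  regroup = solve-∀

¬Rep-G₂ : ∀ a′ κ′ e λ′ → suc κ′ + λ′ ≡ suc (2 * e) → ¬ Rep (suc a′) (B a′ κ′ e) (G₂ a′ κ′ e)
¬Rep-G₂ a′ κ′ e λ′ κ+λ rep =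
  let t , c , y , z , w , budget , tP≡ , zw≡ =
        Rep-double-split (suc a′) (B a′ κ′ e) (G₂ a′ κ′ e) (2 * a′ + κ′ + 1) (λ′ + 2 * a′)
          (double-G₂ a′ κ′ e λ′ κ+λ) rep
  in <⇒≱ (over-budget t c y z w tP≡ zw≡) budget
  where
  open ≤-Reasoning
  P = suc (2 * suc a′)
  over-budget : ∀ t c y z w → suc t * P ≡ suc y + c →
    suc (λ′ + 2 * a′) + (z * P + w) ≡ suc c * suc (2 * B a′ κ′ e) →
    suc (2 * a′ + κ′ + 1) + t < y + z + w
  over-budget t c y z w tP≡ zw≡ = begin-strict
    suc (2 * a′ + κ′ + 1) + t  <⟨ m+k≡n⇒m≤n (t * (2 * suc a′)) (slack a′ κ′ t) ⟩
    suc t * P + κ′             ≡⟨ cong (_+ κ′) tP≡ ⟩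
    suc y + c + κ′             ≤⟨ m+k≡n⇒m≤n (c * κ′) (expand y c κ′) ⟩
    y + suc c * suc κ′         ≤⟨ +-monoʳ-≤ y digits ⟩
    y + (z + w)                ≡⟨ sym (+-assoc y z w) ⟩
    y + z + w                  ∎
    where
    digits : suc c * suc κ′ ≤ z + w
    digits = digits-bound P (suc κ′) λ′ (λ′ + 2 * a′) c z w (m+k≡n⇒m≤n 1 (small a′ λ′))
      (trans zw≡ (cong (suc c *_) (Q-decomposition (suc a′) (suc κ′) e λ′ κ+λ)))
      where
      small : ∀ a′ λ′ → suc (suc (λ′ + 2 * a′)) + 1 ≡ suc (2 * suc a′) + λ′
      small = solve-∀
    slack : ∀ a′ κ′ t → suc (suc (2 * a′ + κ′ + 1) + t) + t * (2 * suc a′) ≡ suc t * suc (2 * suc a′) + κ′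
    slack = solve-∀
    expand : ∀ y c κ′ → suc y + c + κ′ + c * κ′ ≡ y + suc c * suc κ′
    expand = solve-∀

¬Rep-G₀ : ∀ a′ κ′ e λ′ → suc κ′ + λ′ ≡ suc (2 * e) → 2 * suc a′ ≤ κ′ + λ′ → λ′ ≤ 2 * suc a′ →
  ¬ Rep (suc a′) (B a′ κ′ e) (G₀ a′ κ′ e)
¬Rep-G₀ a′ κ′ e λ′ κ+λ p≤κ+λ λ<p rep =
  let t , c , y , z , w , budget , tP≡ , zw≡ =
        Rep-double-split (suc a′) (B a′ κ′ e) (G₀ a′ κ′ e) (4 * a′ + κ′ + 1) λ′
          (double-G₀ a′ κ′ e λ′ κ+λ) rep
  in <⇒≱ (over-budget t c y z w tP≡ zw≡) budget
  where
  open ≤-Reasoning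
  A = 2 * suc a′
  over-budget : ∀ t c y z w → suc t * suc A ≡ suc y + c →
    suc λ′ + (z * suc A + w) ≡ suc c * suc (2 * B a′ κ′ e) →
    suc (4 * a′ + κ′ + 1) + t < y + z + w
  over-budget t c y z w tP≡ zw≡ = s≤s⁻¹ (begin
    suc (suc (suc (4 * a′ + κ′ + 1) + t))  ≤⟨ m+k≡n⇒m≤n (1 + t * A) (slack a′ κ′ t) ⟩
    suc t * suc A + κ′ + A                 ≡⟨ cong (λ m → m + κ′ + A) tP≡ ⟩
    suc y + c + κ′ + A                     ≡⟨ regroup y c κ′ A ⟩
    suc (y + (c + κ′ + A))                 ≤⟨ s≤s (+-monoʳ-≤ y digits) ⟩
    suc (y + (z + w))                      ≡⟨ cong suc (sym (+-assoc y z w)) ⟩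
    suc (y + z + w)                        ∎)
    where
    digits : c + κ′ + A ≤ z + w
    digits = digits-bound-large A κ′ λ′ c z w p≤κ+λ λ<p
      (trans zw≡ (cong (suc c *_) (Q-decomposition (suc a′) (suc κ′) e λ′ κ+λ)))
    slack : ∀ a′ κ′ t → suc (suc (suc (4 * a′ + κ′ + 1) + t)) + (1 + t * (2 * suc a′))
      ≡ suc t * suc (2 * suc a′) + κ′ + 2 * suc a′
    slack = solve-∀
    regroup : ∀ y c κ′ A → suc y + c + κ′ + A ≡ suc (y + (c + κ′ + A))
    regroup = solve-∀

G₀-representation : ∀ e h κ′ l′ → suc κ′ + suc l′ ≡ suc (2 * e) →
  Rep (suc (e + h)) (B (e + h) κ′ e) (G₀ (e + h) κ′ e)
G₀-representation e h κ′ l′ κ+λ =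
  h , 2 * (e + h) + 1 , 2 * suc κ′ , l′ , +-cancelʳ-≡ (suc κ′ * D′) _ _ (begin
  G₀ (e + h) κ′ e + suc κ′ * D′  ≡⟨ formula e h κ′ ⟩
  X + 2 * e * D′                 ≡⟨ cong (λ m → X + m * D′) (sym κ+l′) ⟩
  X + (suc κ′ + l′) * D′         ≡⟨ split X κ′ l′ D′ ⟩
  X + l′ * D′ + suc κ′ * D′      ∎)
  where
  open ≡-Reasoning
  a = suc (e + h)
  b = B (e + h) κ′ e
  D′ = D a b
  X = h * (suc (2 * a) * suc (2 * b)) + (2 * (e + h) + 1) * (a * suc (2 * b)) + 2 * suc κ′ * (suc (2 * a) * b)
  κ+l′ : suc κ′ + l′ ≡ 2 * e
  κ+l′ = suc-injective (trans (sym (+-suc (suc κ′) l′)) κ+λ)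
  formula : ∀ e h κ′ → let a = suc (e + h) ; b = suc κ′ * a + e ; D = 2 * a * b + a + b in
    (4 * (e + h) + κ′ + 1) * D + (2 * (e + h) + 1 + e) + suc κ′ * D
      ≡ h * (suc (2 * a) * suc (2 * b)) + (2 * (e + h) + 1) * (a * suc (2 * b))
        + 2 * suc κ′ * (suc (2 * a) * b) + 2 * e * D
  formula = solve-∀
  split : ∀ X κ′ l′ D → X + (suc κ′ + l′) * D ≡ X + l′ * D + suc κ′ * D
  split = solve-∀

Rep-G₀ : ∀ a′ κ′ e λ′ → suc κ′ + λ′ ≡ suc (2 * e) → 1 ≤ λ′ → e ≤ a′ →
  Rep (suc a′) (B a′ κ′ e) (G₀ a′ κ′ e)
Rep-G₀ a′ κ′ e (suc l′) κ+λ _ e≤a′ =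
  let h , e+h≡ = m≤n⇒∃[o]m+o≡n e≤a′ in
  subst (λ a′ → Rep (suc a′) (B a′ κ′ e) (G₀ a′ κ′ e)) e+h≡ (G₀-representation e h κ′ l′ κ+λ)

¬Rep-G₀⇔ : ∀ a′ κ′ e λ′ → suc κ′ + λ′ ≡ suc (2 * e) → 1 ≤ λ′ → λ′ ≤ 2 * suc a′ →
  (¬ Rep (suc a′) (B a′ κ′ e) (G₀ a′ κ′ e)) ⇔ (suc (2 * suc a′) ≤ suc κ′ + λ′)
¬Rep-G₀⇔ a′ κ′ e λ′ κ+λ 1≤λ λ<p = mk⇔ to (λ p≤κ+λ → ¬Rep-G₀ a′ κ′ e λ′ κ+λ (s≤s⁻¹ p≤κ+λ) λ<p)
  where
  to : ¬ Rep (suc a′) (B a′ κ′ e) (G₀ a′ κ′ e) → suc (2 * suc a′) ≤ suc κ′ + λ′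
  to G₀-gap with e ≤? a′
  ... | yes e≤a′ = ⊥-elim (G₀-gap (Rep-G₀ a′ κ′ e λ′ κ+λ 1≤λ e≤a′))
  ... | no e≰a′ = ≤-trans (s≤s (*-monoʳ-≤ 2 (≰⇒> e≰a′))) (≤-reflexive (sym κ+λ))

-- Representability above g₀, and above g₂ for twin primes

window-split : ∀ T D c r → r < D →
  (∃[ u ] u + suc c ≤ D × suc (T * D + c) + r + u ≡ suc T * D)
  ⊎ (∃[ x ] x ≤ c × suc (T * D + c) + r ≡ suc T * D + x)
window-split T D c r r<D with suc c + r ≤? D
... | yes fits =
  let u , fills = m≤n⇒∃[o]m+o≡n fits in
  inj₁ (u , m+k≡n⇒m≤n r (trans (rotate c r u) fills)
          , trans (regroup T D c r u) (trans (cong (λ m → T * D + m) fills) (+-comm (T * D) D)))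
  where
  rotate : ∀ c r u → u + suc c + r ≡ suc c + r + u
  rotate = solve-∀
  regroup : ∀ T D c r u → suc (T * D + c) + r + u ≡ T * D + (suc c + r + u)
  regroup = solve-∀
... | no spills =
  let r′ , spill = m≤n⇒∃[o]m+o≡n (≰⇒> spills) in
  inj₂ (suc r′ , r′<c r′ spill
          , trans (regroup T D c r) (trans (cong (λ m → T * D + m) (sym spill)) (carry T D r′)))
  where
  open ≤-Reasoning
  regroup : ∀ T D c r → suc (T * D + c) + r ≡ T * D + (suc c + r)
  regroup = solve-∀
  carry : ∀ T D r′ → T * D + (suc D + r′) ≡ suc T * D + suc r′
  carry = solve-∀
  r′<c : ∀ r′ → suc D + r′ ≡ suc c + r → suc r′ ≤ c
  r′<c r′ spill = s≤s⁻¹ (+-cancelˡ-< D (suc r′) (suc c) (begin-strict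
    D + suc r′       ≡⟨ +-suc D r′ ⟩
    suc D + r′       ≡⟨ spill ⟩
    suc c + r        <⟨ +-monoʳ-< (suc c) r<D ⟩
    suc c + D        ≡⟨ +-comm (suc c) D ⟩
    D + suc c        ∎))

Rep-just-above-multiple : ∀ a b s n x → n ≡ s * D a b + x → 2 * x ≤ s → Rep a b n
Rep-just-above-multiple a b s n x n≡ 2x≤s =
  Rep-criterion a b s n x 0 0 n≡ (≤-trans (≤-reflexive (trans (+-identityʳ _) (+-identityʳ _))) 2x≤s)

+-next-multiple : ∀ s D x u n → n ≡ s * D + x → x + u ≡ D → n + u ≡ suc s * D
+-next-multiple s D x u _ refl x+u≡ =
  trans (+-assoc (s * D) x u) (trans (cong (λ m → s * D + m) x+u≡) (+-comm (s * D) D))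

Deficit : ℕ → ℕ → ℕ → ℕ → Set
Deficit a b s u = ∃[ x ] ∃[ y ] ∃[ z ] y * b + z * a ≡ u + x × 2 * x + y + z ≤ s

Rep-of-deficit : ∀ a b s n u → n + u ≡ s * D a b → Deficit a b s u → Rep a b n
Rep-of-deficit a b s n u n+u≡ (x , y , z , eq , budget) =
  Rep-criterion a b s n x y z (trans (cong (_+ n) eq) (trans (regroup u x n) (cong (_+ x) n+u≡))) budget
  where
  regroup : ∀ u x n → u + x + n ≡ n + u + x
  regroup = solve-∀

Deficit-mono : ∀ {a b s s′ u} → s ≤ s′ → Deficit a b s u → Deficit a b s′ u
Deficit-mono s≤s′ (x , y , z , eq , budget) = x , y , z , eq , ≤-trans budget s≤s′

deficit-by-multiple : ∀ a b y v z x → v + x ≡ z * a → Deficit a b (2 * x + y + z) (y * b + v)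
deficit-by-multiple a b y v z x eq =
  x , y , z , trans (cong (λ m → y * b + m) (sym eq)) (sym (+-assoc (y * b) v x)) , ≤-refl

deficit-by-next-b : ∀ a b y v x → v + x ≡ b → Deficit a b (2 * x + suc y) (y * b + v)
deficit-by-next-b a b y v x eq = x , suc y , 0 , b-first , ≤-reflexive (+-identityʳ _)
  where
  b-first : suc y * b + 0 * a ≡ y * b + v + x
  b-first = begin
    b + y * b + 0       ≡⟨ +-identityʳ _ ⟩
    b + y * b           ≡⟨ +-comm b (y * b) ⟩
    y * b + b           ≡⟨ cong (λ m → y * b + m) (sym eq) ⟩
    y * b + (v + x)     ≡⟨ sym (+-assoc (y * b) v x) ⟩
    y * b + v + x       ∎
    where open ≡-Reasoning

ceiling-division : ∀ a′ v → ∃[ z ] ∃[ x ] x ≤ a′ × v + x ≡ z * suc a′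
ceiling-division a′ v = (v + a′) / suc a′ , x , m+k≡n⇒m≤n r r+x≡ , +-cancelʳ-≡ r _ _ (begin
  v + x + r        ≡⟨ +-assoc v x r ⟩
  v + (x + r)      ≡⟨ cong (λ m → v + m) r+x≡ ⟩
  v + a′           ≡⟨ m≡m%n+[m/n]*n (v + a′) (suc a′) ⟩
  r + q * suc a′   ≡⟨ +-comm r _ ⟩
  q * suc a′ + r   ∎)
  where
  open ≡-Reasoning
  r = (v + a′) % suc a′
  q = (v + a′) / suc a′
  r≤a′ : r ≤ a′
  r≤a′ = s≤s⁻¹ (m%n<n (v + a′) (suc a′))
  x = proj₁ (m≤n⇒∃[o]m+o≡n r≤a′)
  r+x≡ : x + r ≡ a′
  r+x≡ = trans (+-comm x r) (proj₂ (m≤n⇒∃[o]m+o≡n r≤a′))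

-- G₀ = (4a′ + κ′ + 1) D + (2a′ + 1 + e): reaching the next multiple of D leaves a deficit with
-- budget 4a′ + κ′ + 2, which suffices up to a (2b + κ′); the multiple after that has one more.
-- The hypothesis 2e ≤ 2a + κ′ used below is λ < p.
G₀-deficit : ℕ → ℕ → ℕ → ℕ → Set
G₀-deficit a′ κ′ e u =
  Deficit (suc a′) (B a′ κ′ e) (4 * a′ + κ′ + 2) u
  ⊎ (suc a′ * (2 * B a′ κ′ e + κ′) < u × Deficit (suc a′) (B a′ κ′ e) (4 * a′ + κ′ + 3) u)

G₀-deficit-≤κa : ∀ a′ κ′ e y v → y ≤ 2 * suc a′ → v ≤ suc κ′ * suc a′ →
  G₀-deficit a′ κ′ e (y * B a′ κ′ e + v)
G₀-deficit-≤κa a′ κ′ e y v y≤ v≤ =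
  let z , x , x≤ , fills = ceiling-division a′ v in
  choose z x x≤ fills (deficit-by-multiple (suc a′) (B a′ κ′ e) y v z x fills)
  where
  open ≤-Reasoning
  a = suc a′
  choose : ∀ z x → x ≤ a′ → v + x ≡ z * a → Deficit a (B a′ κ′ e) (2 * x + y + z) (y * B a′ κ′ e + v) →
    G₀-deficit a′ κ′ e (y * B a′ κ′ e + v)
  choose z x x≤ fills deficit with 2 * x + y + z ≤? 4 * a′ + κ′ + 2
  ... | yes cheap = inj₁ (Deficit-mono cheap deficit)
  ... | no dear = inj₂ (above , Deficit-mono cost deficit)
    where
    z≤κ : z ≤ suc κ′
    z≤κ = s≤s⁻¹ (*-cancelʳ-< a z (suc (suc κ′)) (begin-strict
      z * a                  ≡⟨ sym fills ⟩
      v + x                  ≤⟨ +-mono-≤ v≤ x≤ ⟩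
      suc κ′ * a + a′        <⟨ +-monoʳ-< (suc κ′ * a) (n<1+n a′) ⟩
      suc κ′ * a + a         ≡⟨ +-comm (suc κ′ * a) a ⟩
      suc (suc κ′) * a       ∎))
    total : ∀ a′ κ′ → 2 * a′ + 2 * suc a′ + suc κ′ ≡ 4 * a′ + κ′ + 3
    total = solve-∀
    cost : 2 * x + y + z ≤ 4 * a′ + κ′ + 3
    cost = ≤-trans (+-mono-≤ (+-mono-≤ (*-monoʳ-≤ 2 x≤) y≤) z≤κ) (≤-reflexive (total a′ κ′))
    over : 2 * a′ + 2 * a + suc κ′ ≤ 2 * x + y + z
    over = subst (_≤ 2 * x + y + z) (sym (total′ a′ κ′)) (≰⇒> dear)
      where
      total′ : ∀ a′ κ′ → 2 * a′ + 2 * suc a′ + suc κ′ ≡ suc (4 * a′ + κ′ + 2)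
      total′ = solve-∀
    y-large : 2 * a ≤ y
    y-large = +-cancelˡ-≤ (2 * a′) _ _ (+-cancelʳ-≤ (suc κ′) _ _
      (≤-trans over (+-mono-≤ (+-monoˡ-≤ y (*-monoʳ-≤ 2 x≤)) z≤κ)))
    z-large : suc κ′ ≤ z
    z-large = +-cancelˡ-≤ (2 * a′ + 2 * a) _ _
      (≤-trans over (+-monoˡ-≤ z (+-mono-≤ (*-monoʳ-≤ 2 x≤) y≤)))
    v-large : κ′ * a < v
    v-large = +-cancelʳ-≤ a′ _ _ (begin
      suc (κ′ * a) + a′      ≡⟨ +-comm (suc (κ′ * a)) a′ ⟩
      a′ + suc (κ′ * a)      ≡⟨ +-suc a′ (κ′ * a) ⟩
      suc κ′ * a             ≤⟨ *-monoˡ-≤ a z-large ⟩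
      z * a                  ≡⟨ sym fills ⟩
      v + x                  ≤⟨ +-monoʳ-≤ v x≤ ⟩
      v + a′                 ∎)
    above : a * (2 * B a′ κ′ e + κ′) < y * B a′ κ′ e + v
    above = begin-strict
      a * (2 * B a′ κ′ e + κ′)   ≡⟨ spread a (B a′ κ′ e) κ′ ⟩
      2 * a * B a′ κ′ e + κ′ * a <⟨ +-monoʳ-< (2 * a * B a′ κ′ e) v-large ⟩
      2 * a * B a′ κ′ e + v      ≤⟨ +-monoˡ-≤ v (*-monoˡ-≤ (B a′ κ′ e) y-large) ⟩
      y * B a′ κ′ e + v          ∎
      where
      spread : ∀ a b κ′ → a * (2 * b + κ′) ≡ 2 * a * b + κ′ * a
      spread = solve-∀

G₀-deficit->κa : ∀ a′ κ′ e y t x → 2 * e ≤ 2 * suc a′ + κ′ → y ≤ 2 * suc a′ →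
  suc κ′ * suc a′ + suc t + x ≡ B a′ κ′ e →
  G₀-deficit a′ κ′ e (y * B a′ κ′ e + (suc κ′ * suc a′ + suc t))
G₀-deficit->κa a′ κ′ e y t x λ<p y≤ fills = choose (suc y ≤? 2 * suc a′ + 2 * t)
  where
  open ≤-Reasoning
  a = suc a′
  deficit : Deficit a (B a′ κ′ e) (2 * x + suc y) (y * B a′ κ′ e + (suc κ′ * a + suc t))
  deficit = deficit-by-next-b a (B a′ κ′ e) y (suc κ′ * a + suc t) x fills
  room : 2 * (suc t + x) ≤ 2 * a + κ′
  room = subst (λ m → 2 * m ≤ 2 * a + κ′) (sym e≡) λ<p
    where
    e≡ : suc t + x ≡ e
    e≡ = +-cancelˡ-≡ (suc κ′ * a) (suc t + x) e (trans (sym (+-assoc (suc κ′ * a) (suc t) x)) fills)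
  choose : Dec (suc y ≤ 2 * a + 2 * t) → G₀-deficit a′ κ′ e (y * B a′ κ′ e + (suc κ′ * a + suc t))
  choose (yes cheap) = inj₁ (Deficit-mono cost deficit)
    where
    regroup : ∀ x a′ t → 2 * x + (2 * suc a′ + 2 * t) ≡ 2 * (suc t + x) + 2 * a′
    regroup = solve-∀
    total : ∀ a′ κ′ → 2 * suc a′ + κ′ + 2 * a′ ≡ 4 * a′ + κ′ + 2
    total = solve-∀
    cost : 2 * x + suc y ≤ 4 * a′ + κ′ + 2
    cost = begin
      2 * x + suc y                      ≤⟨ +-monoʳ-≤ (2 * x) cheap ⟩
      2 * x + (2 * a + 2 * t)            ≡⟨ regroup x a′ t ⟩
      2 * (suc t + x) + 2 * a′           ≤⟨ +-monoˡ-≤ (2 * a′) room ⟩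
      2 * a + κ′ + 2 * a′                ≡⟨ total a′ κ′ ⟩
      4 * a′ + κ′ + 2                    ∎
  choose (no dear) = inj₂ (above , Deficit-mono cost deficit)
    where
    y-large : 2 * a ≤ y
    y-large = ≤-trans (m≤m+n (2 * a) (2 * t)) (s≤s⁻¹ (≰⇒> dear))
    slack : ∀ a′ κ′ t b →
      suc (suc a′ * (2 * b + κ′)) + (suc a′ + t) ≡ 2 * suc a′ * b + (suc κ′ * suc a′ + suc t)
    slack = solve-∀
    above : a * (2 * B a′ κ′ e + κ′) < y * B a′ κ′ e + (suc κ′ * a + suc t)
    above = begin-strict
      a * (2 * B a′ κ′ e + κ′)                  <⟨ m+k≡n⇒m≤n (a + t) (slack a′ κ′ t (B a′ κ′ e)) ⟩
      2 * a * B a′ κ′ e + (suc κ′ * a + suc t)  ≤⟨ +-monoˡ-≤ _ (*-monoˡ-≤ (B a′ κ′ e) y-large) ⟩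
      y * B a′ κ′ e + (suc κ′ * a + suc t)      ∎
    shift : ∀ a′ κ′ → 2 * suc a′ + κ′ ≡ 2 + (2 * a′ + κ′)
    shift = solve-∀
    x-small : 2 * x ≤ 2 * a′ + κ′
    x-small = +-cancelˡ-≤ 2 _ _ (begin
      2 + 2 * x          ≡⟨ sym (*-distribˡ-+ 2 1 x) ⟩
      2 * suc x          ≤⟨ *-monoʳ-≤ 2 (s≤s (m≤n+m x t)) ⟩
      2 * (suc t + x)    ≤⟨ room ⟩
      2 * a + κ′         ≡⟨ shift a′ κ′ ⟩
      2 + (2 * a′ + κ′)  ∎)
    total : ∀ a′ κ′ → 2 * a′ + κ′ + suc (2 * suc a′) ≡ 4 * a′ + κ′ + 3
    total = solve-∀
    cost : 2 * x + suc y ≤ 4 * a′ + κ′ + 3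
    cost = ≤-trans (+-mono-≤ x-small (s≤s y≤)) (≤-reflexive (total a′ κ′))

G₀-deficit-<pb : ∀ a′ κ′ e u → 2 * e ≤ 2 * suc a′ + κ′ → u < suc (2 * suc a′) * B a′ κ′ e →
  G₀-deficit a′ κ′ e u
G₀-deficit-<pb a′ κ′ e u λ<p u<pb = subst (G₀-deficit a′ κ′ e) u≡ (by-position (v ≤? suc κ′ * a))
  where
  a = suc a′
  b = B a′ κ′ e
  v = u % b
  y = u / b
  u≡ : y * b + v ≡ u
  u≡ = trans (+-comm (y * b) v) (sym (m≡m%n+[m/n]*n u b))
  y≤ : y ≤ 2 * a
  y≤ = s≤s⁻¹ (*-cancelʳ-< b y (suc (2 * a))
    (≤-<-trans (m≤m+n (y * b) v) (subst (_< suc (2 * a) * b) (sym u≡) u<pb)))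
  beyond : ∀ v t x → suc κ′ * a + suc t ≡ v → v + x ≡ b → G₀-deficit a′ κ′ e (y * b + v)
  beyond _ t x refl fills = G₀-deficit->κa a′ κ′ e y t x λ<p y≤ fills
  by-position : Dec (v ≤ suc κ′ * a) → G₀-deficit a′ κ′ e (y * b + v)
  by-position (yes v≤) = G₀-deficit-≤κa a′ κ′ e y v y≤ v≤
  by-position (no v>) = beyond v (proj₁ κa<v) (proj₁ v≤b)
    (trans (+-suc (suc κ′ * a) _) (proj₂ κa<v)) (proj₂ v≤b)
    where
    κa<v = m≤n⇒∃[o]m+o≡n (≰⇒> v>)
    v≤b = m≤n⇒∃[o]m+o≡n (<⇒≤ (m%n<n u b))

D-as-U : ∀ a′ κ′ e → suc a′ * (2 * B a′ κ′ e + κ′) + suc (2 * a′ + 1 + e) ≡ D (suc a′) (B a′ κ′ e)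
D-as-U = identity
  where
  identity : ∀ a′ κ′ e → let a = suc a′ ; b = suc κ′ * a + e in
    a * (2 * b + κ′) + suc (2 * a′ + 1 + e) ≡ 2 * a * b + a + b
  identity = solve-∀

D-as-pb : ∀ a b → suc (2 * a) * b + a ≡ D a b
D-as-pb = identity
  where
  identity : ∀ a b → suc (2 * a) * b + a ≡ 2 * a * b + a + b
  identity = solve-∀

Deficit-≤U : ∀ a′ κ′ e u → 2 * e ≤ 2 * suc a′ + κ′ → u ≤ suc a′ * (2 * B a′ κ′ e + κ′) →
  Deficit (suc a′) (B a′ κ′ e) (4 * a′ + κ′ + 2) u
Deficit-≤U a′ κ′ e u λ<p u≤U =
  [ id , (λ (U<u , _) → ⊥-elim (<⇒≱ U<u u≤U)) ]′ (G₀-deficit-<pb a′ κ′ e u λ<p u<pb)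
  where
  U = suc a′ * (2 * B a′ κ′ e + κ′)
  u<pb : u < suc (2 * suc a′) * B a′ κ′ e
  u<pb = +-cancelʳ-≤ (suc a′) _ _ (begin
    suc u + suc a′                      ≤⟨ +-mono-≤ (s≤s u≤U) (m≤m+n (suc a′) (a′ + e)) ⟩
    suc U + (suc a′ + (a′ + e))         ≡⟨ regroup U a′ e ⟩
    U + suc (2 * a′ + 1 + e)            ≡⟨ trans (D-as-U a′ κ′ e) (sym (D-as-pb (suc a′) (B a′ κ′ e))) ⟩
    suc (2 * suc a′) * B a′ κ′ e + suc a′ ∎)
    where
    open ≤-Reasoning
    regroup : ∀ U a′ e → suc U + (suc a′ + (a′ + e)) ≡ U + suc (2 * a′ + 1 + e)
    regroup = solve-∀

Deficit-<pb : ∀ a′ κ′ e u → 2 * e ≤ 2 * suc a′ + κ′ → u < suc (2 * suc a′) * B a′ κ′ e →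
  Deficit (suc a′) (B a′ κ′ e) (4 * a′ + κ′ + 3) u
Deficit-<pb a′ κ′ e u λ<p u<pb =
  [ Deficit-mono (+-monoʳ-≤ (4 * a′ + κ′) (n≤1+n 2)) , proj₂ ]′ (G₀-deficit-<pb a′ κ′ e u λ<p u<pb)

G₀-window : ∀ a′ κ′ e r → 2 * e ≤ 2 * suc a′ + κ′ → r < D (suc a′) (B a′ κ′ e) →
  Rep (suc a′) (B a′ κ′ e) (suc (G₀ a′ κ′ e) + r)
G₀-window a′ κ′ e r λ<p r<D =
  [ (λ (u , u+c≤D , n+u≡) → short u u+c≤D n+u≡) , (λ (x , x≤c , n≡) → over x x≤c n≡) ]′
    (window-split T D′ c r r<D)
  where
  open ≤-Reasoning
  a = suc a′
  b = B a′ κ′ e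
  D′ = D a b
  T = 4 * a′ + κ′ + 1
  c = 2 * a′ + 1 + e
  U = a * (2 * b + κ′)
  n = suc (G₀ a′ κ′ e) + r
  step : ∀ a′ κ′ → 4 * a′ + κ′ + 2 ≡ suc (4 * a′ + κ′ + 1)
  step = solve-∀
  short : ∀ u → u + suc c ≤ D′ → n + u ≡ suc T * D′ → Rep a b n
  short u u+c≤D n+u≡ = Rep-of-deficit a b (suc T) n u n+u≡
    (Deficit-mono (≤-reflexive (step a′ κ′)) (Deficit-≤U a′ κ′ e u λ<p u≤U))
    where
    u≤U : u ≤ U
    u≤U = +-cancelʳ-≤ (suc c) u U (subst (u + suc c ≤_) (sym (D-as-U a′ κ′ e)) u+c≤D)
  over : ∀ x → x ≤ c → n ≡ suc T * D′ + x → Rep a b n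
  over x x≤c n≡ with 2 * x ≤? suc T
  ... | yes cheap = Rep-just-above-multiple a b (suc T) n x n≡ cheap
  ... | no dear = Rep-of-deficit a b (suc (suc T)) n u (+-next-multiple (suc T) D′ x u n n≡ x+u≡)
    (Deficit-mono (≤-reflexive (step′ a′ κ′)) (Deficit-<pb a′ κ′ e u λ<p u<pb))
    where
    step′ : ∀ a′ κ′ → 4 * a′ + κ′ + 3 ≡ suc (suc (4 * a′ + κ′ + 1))
    step′ = solve-∀
    x≤D : x ≤ D′
    x≤D = ≤-trans x≤c (≤-trans (n≤1+n c) (≤-trans (m≤n+m (suc c) U) (≤-reflexive (D-as-U a′ κ′ e))))
    u = proj₁ (m≤n⇒∃[o]m+o≡n x≤D)
    x+u≡ : x + u ≡ D′
    x+u≡ = proj₂ (m≤n⇒∃[o]m+o≡n x≤D)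
    a<x : a < x
    a<x = *-cancelˡ-< 2 a x (≤-<-trans (m+k≡n⇒m≤n (2 * a′ + κ′) (grow a′ κ′)) (≰⇒> dear))
      where
      grow : ∀ a′ κ′ → 2 * suc a′ + (2 * a′ + κ′) ≡ suc (4 * a′ + κ′ + 1)
      grow = solve-∀
    u<pb : u < suc (2 * a) * b
    u<pb = +-cancelʳ-< x u _ (begin-strict
      u + x                  ≡⟨ +-comm u x ⟩
      x + u                  ≡⟨ x+u≡ ⟩
      D′                     ≡⟨ sym (D-as-pb a b) ⟩
      suc (2 * a) * b + a    <⟨ +-monoʳ-< (suc (2 * a) * b) a<x ⟩
      suc (2 * a) * b + x    ∎)

Rep-above-G₀ : ∀ a′ κ′ e → 2 * e ≤ 2 * suc a′ + κ′ → ∀ n → G₀ a′ κ′ e < n →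
  Rep (suc a′) (B a′ κ′ e) n
Rep-above-G₀ a′ κ′ e λ<p =
  Rep-beyond (suc a′) (B a′ κ′ e) (G₀ a′ κ′ e) z<s (λ r → G₀-window a′ κ′ e r λ<p)

twin-deficit-exact : ∀ a m y → y ≤ m → Deficit a (suc a) m (m * a + y)
twin-deficit-exact a m y y≤m =
  let z , y+z≡ = m≤n⇒∃[o]m+o≡n y≤m in
  0 , y , z , trans (regroup y z a) (cong (λ k → k * a + y + 0) y+z≡) , ≤-reflexive y+z≡
  where
  regroup : ∀ y z a → y * suc a + z * a ≡ (y + z) * a + y + 0
  regroup = solve-∀

twin-deficit : ∀ a′ u → u ≤ 2 * suc a′ * suc a′ + 2 * suc a′ →
  Deficit (suc a′) (suc (suc a′)) (2 * suc a′) u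
twin-deficit a′ u u≤ = by-size (2 * a * a ≤? u)
  where
  open ≤-Reasoning
  a = suc a′
  R = u % a
  Q = u / a
  u≡ : Q * a + R ≡ u
  u≡ = trans (+-comm (Q * a) R) (sym (m≡m%n+[m/n]*n u a))
  by-digits : 2 * a * a ≰ u → Dec (R ≤ Q) → Deficit a (suc a) (2 * a) u
  by-size : Dec (2 * a * a ≤ u) → Deficit a (suc a) (2 * a) u
  by-size (yes big) =
    let y , eq = m≤n⇒∃[o]m+o≡n big in
    subst (Deficit a (suc a) (2 * a)) eq (twin-deficit-exact a (2 * a) y
      (+-cancelˡ-≤ (2 * a * a) y (2 * a) (subst (_≤ 2 * a * a + 2 * a) (sym eq) u≤)))
  by-size (no small) = by-digits small (R ≤? Q)
  by-digits small (yes R≤Q) =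
    subst (Deficit a (suc a) (2 * a)) u≡ (Deficit-mono (<⇒≤ Q<2a) (twin-deficit-exact a Q R R≤Q))
    where
    Q<2a : Q < 2 * a
    Q<2a = *-cancelʳ-< a Q (2 * a)
      (≤-<-trans (m≤m+n (Q * a) R) (subst (_< 2 * a * a) (sym u≡) (≰⇒> small)))
  by-digits _ (no Q<R) =
    let x , R+x≡ = m≤n⇒∃[o]m+o≡n (<⇒≤ (m%n<n u a)) in
    Deficit-mono (cost x R+x≡) (deficit-by-multiple a (suc a) 0 u (suc Q) x (fills x R+x≡))
    where
    fills : ∀ x → R + x ≡ a → u + x ≡ suc Q * a
    fills x R+x≡ = begin-equality
      u + x              ≡⟨ cong (_+ x) (sym u≡) ⟩
      Q * a + R + x      ≡⟨ +-assoc (Q * a) R x ⟩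
      Q * a + (R + x)    ≡⟨ cong (λ m → Q * a + m) R+x≡ ⟩
      Q * a + a          ≡⟨ +-comm (Q * a) a ⟩
      suc Q * a          ∎
    cost : ∀ x → R + x ≡ a → 2 * x + 0 + suc Q ≤ 2 * a
    cost x R+x≡ = begin
      2 * x + 0 + suc Q   ≤⟨ +-monoʳ-≤ (2 * x + 0) (≰⇒> Q<R) ⟩
      2 * x + 0 + R       ≤⟨ +-monoʳ-≤ (2 * x + 0) (m≤m+n R R) ⟩
      2 * x + 0 + (R + R) ≡⟨ regroup x R ⟩
      2 * (R + x)         ≡⟨ cong (2 *_) R+x≡ ⟩
      2 * a               ∎
      where
      regroup : ∀ x R → 2 * x + 0 + (R + R) ≡ 2 * (R + x)
      regroup = solve-∀

twin-b : ∀ a′ → B a′ 0 1 ≡ suc (suc a′)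
twin-b a′ = trans (+-comm (suc a′ + 0) 1) (cong suc (+-identityʳ (suc a′)))

twin-D : ∀ a′ → D (suc a′) (B a′ 0 1) ≡ suc (2 * suc a′) * suc a′ + suc (3 * suc a′)
twin-D a′ = identity a′
  where
  identity : ∀ a′ → let a = suc a′ ; b = 1 * a + 1 in
    2 * a * b + a + b ≡ suc (2 * a) * a + suc (3 * a)
  identity = solve-∀

twin-window : ∀ a′ r → r < D (suc a′) (B a′ 0 1) → Rep (suc a′) (B a′ 0 1) (suc (G₂ a′ 0 1) + r)
twin-window a′ r r<D =
  [ (λ (u , u+c≤D , n+u≡) → short u u+c≤D n+u≡) , (λ (x , x≤c , n≡) → over x x≤c n≡) ]′
    (window-split T D′ c r r<D)
  where
  open ≤-Reasoning
  a = suc a′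
  b = B a′ 0 1
  D′ = D a b
  T = 2 * a′ + 0 + 1
  c = 2 * a′ + 1 + 1
  n = suc (G₂ a′ 0 1) + r
  transport-b : ∀ s u → Deficit a (suc a) s u → Deficit a b s u
  transport-b s u = subst (λ b → Deficit a b s u) (sym (twin-b a′))
  step : ∀ a′ → 2 * suc a′ ≡ suc (2 * a′ + 0 + 1)
  step = solve-∀
  short : ∀ u → u + suc c ≤ D′ → n + u ≡ suc T * D′ → Rep a b n
  short u u+c≤D n+u≡ = Rep-of-deficit a b (suc T) n u n+u≡
    (Deficit-mono (≤-reflexive (step a′)) (transport-b (2 * a) u (twin-deficit a′ u u≤)))
    where
    split-D : ∀ a′ → let a = suc a′ ; b = 1 * a + 1 in
      2 * a * b + a + b ≡ 2 * a * a + 2 * a + suc (2 * a′ + 1 + 1)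
    split-D = solve-∀
    u≤ : u ≤ 2 * a * a + 2 * a
    u≤ = +-cancelʳ-≤ (suc c) u _ (subst (u + suc c ≤_) (split-D a′) u+c≤D)
  over : ∀ x → x ≤ c → n ≡ suc T * D′ + x → Rep a b n
  over x x≤c n≡ with 2 * x ≤? suc T
  ... | yes cheap = Rep-just-above-multiple a b (suc T) n x n≡ cheap
  ... | no dear =
    let y , x+y≡ = m≤n⇒∃[o]m+o≡n x≤3a+1 in
    Rep-of-deficit a b (suc (suc T)) n _ (+-next-multiple (suc T) D′ x _ n n≡ (x+u≡ y x+y≡))
      (Deficit-mono (≤-reflexive (cong suc (step a′)))
        (transport-b _ _ (twin-deficit-exact a (suc (2 * a)) y (y≤ y x+y≡))))
    where
    three : ∀ a′ → 2 * a′ + 1 + 1 + suc (suc a′) ≡ suc (3 * suc a′)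
    three = solve-∀
    x≤3a+1 : x ≤ suc (3 * a)
    x≤3a+1 = ≤-trans x≤c (m+k≡n⇒m≤n (suc (suc a′)) (three a′))
    a<x : a < x
    a<x = *-cancelˡ-< 2 a x (subst (_< 2 * x) (sym (step a′)) (≰⇒> dear))
    y≤ : ∀ y → x + y ≡ suc (3 * a) → y ≤ suc (2 * a)
    y≤ y x+y≡ = ≤-trans (+-cancelˡ-≤ (suc a) y (2 * a) (begin
      suc a + y          ≤⟨ +-monoˡ-≤ y a<x ⟩
      x + y              ≡⟨ x+y≡ ⟩
      suc (3 * a)        ≡⟨ split a ⟩
      suc a + 2 * a      ∎)) (n≤1+n (2 * a))
      where
      split : ∀ a → suc (3 * a) ≡ suc a + 2 * a
      split = solve-∀
    x+u≡ : ∀ y → x + y ≡ suc (3 * a) → x + (suc (2 * a) * a + y) ≡ D′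
    x+u≡ y x+y≡ = begin-equality
      x + (suc (2 * a) * a + y)     ≡⟨ swap x (suc (2 * a) * a) y ⟩
      suc (2 * a) * a + (x + y)     ≡⟨ cong (λ m → suc (2 * a) * a + m) x+y≡ ⟩
      suc (2 * a) * a + suc (3 * a) ≡⟨ sym (twin-D a′) ⟩
      D′                            ∎
      where
      swap : ∀ x U y → x + (U + y) ≡ U + (x + y)
      swap = solve-∀

Rep-above-G₂-twin : ∀ a′ n → G₂ a′ 0 1 < n → Rep (suc a′) (B a′ 0 1) n
Rep-above-G₂-twin a′ = Rep-beyond (suc a′) (B a′ 0 1) (G₂ a′ 0 1) z<s (twin-window a′)

-- The values of g₀ and g₂

f-odd : ∀ a b x y z w → let P = suc (2 * a) ; Q = suc (2 * b) in
  f P Q x y z w ≡ x ℤ.* + (P * Q) ℤ.+ y ℤ.* + (a * Q) ℤ.+ z ℤ.* + (P * b) ℤ.+ w ℤ.* + D a b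
f-odd a b x y z w =
  trans (cong₂ (λ h k → x ℤ.* + (P * Q) ℤ.+ y ℤ.* + (h * Q) ℤ.+ z ℤ.* + (P * k) ℤ.+ w ℤ.* + d3 P Q)
               (half-1-odd a) (half-1-odd b))
        (cong (λ d → x ℤ.* + (P * Q) ℤ.+ y ℤ.* + (a * Q) ℤ.+ z ℤ.* + (P * b) ℤ.+ w ℤ.* + d) (d3-odd a b))
  where
  P = suc (2 * a)
  Q = suc (2 * b)

+[m+n]-n≡m : ∀ m n → + (m + n) ℤ.- + n ≡ + m
+[m+n]-n≡m m n = trans (ℤ.m-n≡m⊖n (m + n) n) (trans (ℤ.⊖-≥ (m≤n+m n m)) (cong +_ (m+n∸n≡m m n)))

+*+sum : ∀ x y z X Y Z → + x ℤ.* + X ℤ.+ + y ℤ.* + Y ℤ.+ + z ℤ.* + Z ≡ + (x * X + y * Y + z * Z)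
+*+sum x y z X Y Z = sym (cong₂ ℤ._+_ (cong₂ ℤ._+_ (ℤ.pos-* x X) (ℤ.pos-* y Y)) (ℤ.pos-* z Z))

g₀-value : ∀ a′ κ′ e → g₀ (suc (2 * suc a′)) (suc (2 * B a′ κ′ e)) (suc κ′) ≡ + G₀ a′ κ′ e
g₀-value a′ κ′ e = begin
  g₀ P Q (suc κ′)
    ≡⟨ f-odd a b (+ half-1 P ℤ.- + 1) (+ P ℤ.- + 1) (+ suc κ′) (ℤ.- + 1) ⟩
  (+ half-1 P ℤ.- + 1) ℤ.* + (P * Q) ℤ.+ + (2 * a) ℤ.* + (a * Q) ℤ.+ + suc κ′ ℤ.* + (P * b)
    ℤ.+ ℤ.-1ℤ ℤ.* + D a b
    ≡⟨ cong₂ (λ h m → (+ h ℤ.- + 1) ℤ.* + (P * Q) ℤ.+ + (2 * a) ℤ.* + (a * Q) ℤ.+ + suc κ′ ℤ.* + (P * b)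
                        ℤ.+ m)
             (half-1-odd a) (ℤ.-1*i≡-i (+ D a b)) ⟩
  + a′ ℤ.* + (P * Q) ℤ.+ + (2 * a) ℤ.* + (a * Q) ℤ.+ + suc κ′ ℤ.* + (P * b) ℤ.- + D a b
    ≡⟨ cong (ℤ._- + D a b) (+*+sum a′ (2 * a) (suc κ′) (P * Q) (a * Q) (P * b)) ⟩
  + (a′ * (P * Q) + 2 * a * (a * Q) + suc κ′ * (P * b)) ℤ.- + D a b
    ≡⟨ cong (λ m → + m ℤ.- + D a b) (formula a′ κ′ e) ⟩
  + (G₀ a′ κ′ e + D a b) ℤ.- + D a b
    ≡⟨ +[m+n]-n≡m (G₀ a′ κ′ e) (D a b) ⟩
  + G₀ a′ κ′ e ∎
  where
  open ≡-Reasoning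
  a = suc a′
  b = B a′ κ′ e
  P = suc (2 * a)
  Q = suc (2 * b)
  formula : ∀ a′ κ′ e →
    let a = suc a′ ; b = suc κ′ * a + e ; D = 2 * a * b + a + b ; P = suc (2 * a) ; Q = suc (2 * b) in
    a′ * (P * Q) + 2 * a * (a * Q) + suc κ′ * (P * b) ≡ (4 * a′ + κ′ + 1) * D + (2 * a′ + 1 + e) + D
  formula = solve-∀

g₂-value : ∀ a′ κ′ e → g₂ (suc (2 * suc a′)) (suc (2 * B a′ κ′ e)) (suc κ′) ≡ + G₂ a′ κ′ e
g₂-value a′ κ′ e = begin
  g₂ P Q (suc κ′)
    ≡⟨ cong₂ (λ g d → g ℤ.- (+ P ℤ.- + 3) ℤ.* + d) (g₀-value a′ κ′ e) (d3-odd a b) ⟩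
  + G₀ a′ κ′ e ℤ.- (+ P ℤ.- + 3) ℤ.* + D a b
    ≡⟨ cong (λ m → + G₀ a′ κ′ e ℤ.- (+ m ℤ.- + 3) ℤ.* + D a b) (three-plus a′) ⟩
  + G₀ a′ κ′ e ℤ.- + (2 * a′) ℤ.* + D a b
    ≡⟨ cong (λ m → + G₀ a′ κ′ e ℤ.- m) (sym (ℤ.pos-* (2 * a′) (D a b))) ⟩
  + G₀ a′ κ′ e ℤ.- + (2 * a′ * D a b)
    ≡⟨ cong (λ m → + m ℤ.- + (2 * a′ * D a b)) (formula a′ κ′ e) ⟩
  + (G₂ a′ κ′ e + 2 * a′ * D a b) ℤ.- + (2 * a′ * D a b)
    ≡⟨ +[m+n]-n≡m (G₂ a′ κ′ e) (2 * a′ * D a b) ⟩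
  + G₂ a′ κ′ e ∎
  where
  open ≡-Reasoning
  a = suc a′
  b = B a′ κ′ e
  P = suc (2 * a)
  Q = suc (2 * b)
  three-plus : ∀ a′ → suc (2 * suc a′) ≡ 3 + 2 * a′
  three-plus = solve-∀
  formula : ∀ a′ κ′ e → let a = suc a′ ; b = suc κ′ * a + e ; D = 2 * a * b + a + b in
    (4 * a′ + κ′ + 1) * D + (2 * a′ + 1 + e) ≡ (2 * a′ + κ′ + 1) * D + (2 * a′ + 1 + e) + 2 * a′ * D
  formula = solve-∀

-- The Frobenius number

frobenius≤ : ∀ {p q g} G → IsFrobenius p q g → (∀ n → G < n → Representable p q n) → g ≤ G
frobenius≤ G (_ , g-gap , _) above = ≮⇒≥ (λ G<g → g-gap (above _ G<g))

gap≤frobenius : ∀ {p q g} G → IsFrobenius p q g → ¬ Representable p q G → G ≤ g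
gap≤frobenius G (_ , _ , above) G-gap = ≮⇒≥ (λ g<G → G-gap (above _ g<G))

frobenius≡⇔gap : ∀ {p q g} G → IsFrobenius p q g → (∀ n → G < n → Representable p q n) →
  (g ≡ G) ⇔ (¬ Representable p q G)
frobenius≡⇔gap {p} {q} G frob@(_ , g-gap , _) above =
  mk⇔ (λ { refl → g-gap })
      (λ G-gap → ≤-antisym (frobenius≤ {p} {q} G frob above) (gap≤frobenius {p} {q} G frob G-gap))

odd-prime : ∀ p → Prime p → 2 < p → ∃[ a ] p ≡ suc (2 * a)
odd-prime p p-prime 2<p with p % 2 | m≡m%n+[m/n]*n p 2 | m%n<n p 2
... | 0 | p≡ | _ with prime⇒irreducible p-prime (divides (p / 2) p≡)
...   | inj₁ ()
...   | inj₂ refl = ⊥-elim (<-irrefl refl 2<p)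
odd-prime p p-prime 2<p | 1 | p≡ | _ = p / 2 , trans p≡ (cong suc (*-comm (p / 2) 2))
odd-prime p p-prime 2<p | suc (suc _) | _ | s≤s (s≤s ())

odd-quotient : ∀ a b κ′ λ′ → suc (2 * b) ≡ suc κ′ * suc (2 * a) + λ′ →
  ∃[ e ] b ≡ suc κ′ * a + e × suc κ′ + λ′ ≡ suc (2 * e)
odd-quotient a b κ′ λ′ q≡ =
  let e , b≡ = m≤n⇒∃[o]m+o≡n κa≤b in
  e , sym b≡ , +-cancelˡ-≡ (2 * (suc κ′ * a)) _ _ (begin
    2 * (suc κ′ * a) + (suc κ′ + λ′)  ≡⟨ sym (expand κ′ a λ′) ⟩
    suc κ′ * suc (2 * a) + λ′         ≡⟨ sym q≡ ⟩
    suc (2 * b)                       ≡⟨ cong (λ m → suc (2 * m)) (sym b≡) ⟩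
    suc (2 * (suc κ′ * a + e))        ≡⟨ collect κ′ a e ⟩
    2 * (suc κ′ * a) + suc (2 * e)    ∎)
  where
  open ≡-Reasoning
  expand : ∀ κ′ a λ′ → suc κ′ * suc (2 * a) + λ′ ≡ 2 * (suc κ′ * a) + (suc κ′ + λ′)
  expand = solve-∀
  collect : ∀ κ′ a e → suc (2 * (suc κ′ * a + e)) ≡ 2 * (suc κ′ * a) + suc (2 * e)
  collect = solve-∀
  κa≤b : suc κ′ * a ≤ b
  κa≤b = *-cancelˡ-≤ 2 (m+k≡n⇒m≤n (κ′ + λ′)
    (suc-injective (trans (sym (+-suc _ (κ′ + λ′))) (trans (sym (expand κ′ a λ′)) (sym q≡)))))

prime-pair-parameters : ∀ p q κ λ′ → Prime p → Prime q → 2 < p → p < q →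
  q ≡ κ * p + λ′ → λ′ ≤ p ∸ 1 →
  ∃[ a′ ] ∃[ κ′ ] ∃[ e ]
    p ≡ suc (2 * suc a′) × q ≡ suc (2 * B a′ κ′ e) × κ ≡ suc κ′ × suc κ′ + λ′ ≡ suc (2 * e)
prime-pair-parameters p q κ λ′ p-prime q-prime 2<p p<q q≡ λ<p
  with odd-prime p p-prime 2<p | odd-prime q q-prime (<-trans 2<p p<q) | κ
... | zero , refl | _ | _ = ⊥-elim (<⇒≱ 2<p (s≤s z≤n))
... | suc a′ , refl | b , refl | zero = ⊥-elim (<⇒≱ p<q (≤-trans (≤-reflexive q≡) (≤-trans λ<p (n≤1+n _))))
... | suc a′ , refl | b , refl | suc κ′ =
  let e , b≡ , κ+λ = odd-quotient (suc a′) b κ′ λ′ q≡ in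
  a′ , κ′ , e , refl , cong (λ m → suc (2 * m)) b≡ , refl , κ+λ

twin-parameters : ∀ a′ κ′ e λ′ → suc κ′ + λ′ ≡ suc (2 * e) → 1 ≤ λ′ →
  suc (2 * B a′ κ′ e) ≡ suc (2 * suc a′) + 2 → κ′ ≡ 0 × e ≡ 1
twin-parameters a′ κ′ zero (suc l′) κ+λ _ _ with trans (sym (+-suc κ′ l′)) (suc-injective κ+λ)
... | ()
twin-parameters a′ κ′ (suc e′) λ′ κ+λ _ q≡p+2 =
  m*n≡0⇒m≡0 κ′ (suc a′) (m+n≡0⇒m≡0 _ rest≡0) , cong suc (m+n≡0⇒n≡0 (κ′ * suc a′) rest≡0)
  where
  double : ∀ a′ → suc (2 * suc a′) + 2 ≡ suc (2 * (suc a′ + 1))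
  double = solve-∀
  split : ∀ a′ κ′ e′ → suc κ′ * suc a′ + suc e′ ≡ suc a′ + 1 + (κ′ * suc a′ + e′)
  split = solve-∀
  b≡ : B a′ κ′ (suc e′) ≡ suc a′ + 1
  b≡ = *-cancelˡ-≡ _ _ 2 (suc-injective (trans q≡p+2 (double a′)))
  rest≡0 : κ′ * suc a′ + e′ ≡ 0
  rest≡0 = +-cancelˡ-≡ (suc a′ + 1) _ 0 (trans (sym (split a′ κ′ e′)) (trans b≡ (sym (+-identityʳ _))))

theorem-odd : ∀ a′ κ′ e λ′ → suc κ′ + λ′ ≡ suc (2 * e) → 1 ≤ λ′ → λ′ ≤ 2 * suc a′ → ∀ g →
  let p = suc (2 * suc a′) ; q = suc (2 * B a′ κ′ e) in
  IsFrobenius p q g →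
  ((g₂ p q (suc κ′) ≤ℤ + g) × (+ g ≤ℤ g₀ p q (suc κ′)))
  × ((+ g ≡ g₀ p q (suc κ′)) ⇔ (suc κ′ + λ′ ≥ p))
  × ((p ≡ 3 ⊎ q ≡ p + 2) → + g ≡ g₂ p q (suc κ′))
theorem-odd a′ κ′ e λ′ κ+λ 1≤λ λ<p g frob = bounds , g≡g₀⇔ , g≡g₂
  where
  a = suc a′
  b = B a′ κ′ e
  p = suc (2 * a)
  q = suc (2 * b)
  rep⇒ : ∀ {n} → Rep a b n → Representable p q n
  rep⇒ = Equivalence.from (Representable⇔Rep a b _)
  ⇒rep : ∀ {n} → Representable p q n → Rep a b n
  ⇒rep = Equivalence.to (Representable⇔Rep a b _)
  2e≤ : 2 * e ≤ 2 * a + κ′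
  2e≤ = ≤-trans (≤-reflexive (suc-injective (sym κ+λ)))
    (≤-trans (+-monoʳ-≤ κ′ λ<p) (≤-reflexive (+-comm κ′ (2 * a))))
  above-G₀ : ∀ n → G₀ a′ κ′ e < n → Representable p q n
  above-G₀ n = rep⇒ ∘ Rep-above-G₀ a′ κ′ e 2e≤ n
  g≤G₀ : g ≤ G₀ a′ κ′ e
  g≤G₀ = frobenius≤ {p} {q} (G₀ a′ κ′ e) frob above-G₀
  G₂≤g : G₂ a′ κ′ e ≤ g
  G₂≤g = gap≤frobenius {p} {q} (G₂ a′ κ′ e) frob (¬Rep-G₂ a′ κ′ e λ′ κ+λ ∘ ⇒rep)
  bounds : (g₂ p q (suc κ′) ≤ℤ + g) × (+ g ≤ℤ g₀ p q (suc κ′))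
  bounds = subst (_≤ℤ + g) (sym (g₂-value a′ κ′ e)) (ℤ.+≤+ G₂≤g)
         , subst (+ g ≤ℤ_) (sym (g₀-value a′ κ′ e)) (ℤ.+≤+ g≤G₀)
  open Equivalence
  g≡G₀⇔ = frobenius≡⇔gap {p} {q} (G₀ a′ κ′ e) frob above-G₀
  G₀-gap⇔ = ¬Rep-G₀⇔ a′ κ′ e λ′ κ+λ 1≤λ λ<p
  g≡g₀⇔ : (+ g ≡ g₀ p q (suc κ′)) ⇔ (suc κ′ + λ′ ≥ p)
  g≡g₀⇔ = mk⇔
    (λ g≡ → to G₀-gap⇔ (to g≡G₀⇔ (ℤ.+-injective (trans g≡ (g₀-value a′ κ′ e))) ∘ rep⇒))
    (λ p≤κ+λ → trans (cong +_ (from g≡G₀⇔ (from G₀-gap⇔ p≤κ+λ ∘ ⇒rep))) (sym (g₀-value a′ κ′ e)))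
  g≡G₂ : g ≤ G₂ a′ κ′ e → + g ≡ g₂ p q (suc κ′)
  g≡G₂ g≤G₂ = trans (cong +_ (≤-antisym g≤G₂ G₂≤g)) (sym (g₂-value a′ κ′ e))
  g≡g₂ : p ≡ 3 ⊎ q ≡ p + 2 → + g ≡ g₂ p q (suc κ′)
  g≡g₂ (inj₁ p≡3) = g≡G₂ (subst (g ≤_) (subst (λ a′ → G₀ a′ κ′ e ≡ G₂ a′ κ′ e) (sym a′≡0) refl) g≤G₀)
    where
    a′≡0 : a′ ≡ 0
    a′≡0 = suc-injective (*-cancelˡ-≡ (suc a′) 1 2 (suc-injective p≡3))
  g≡g₂ (inj₂ q≡p+2) = g≡G₂ (frobenius≤ {p} {q} (G₂ a′ κ′ e) frob (λ n → rep⇒ ∘ twin-above n))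
    where
    twin-above : ∀ n → G₂ a′ κ′ e < n → Rep a b n
    twin-above with twin-parameters a′ κ′ e λ′ κ+λ 1≤λ q≡p+2
    ... | refl , refl = Rep-above-G₂-twin a′

theorem2p1 : (p q : ℕ) → Prime p → Prime q → 2 < p → p < q →
    (κ λ′ : ℕ) → q ≡ κ * p + λ′ → 1 ≤ λ′ → λ′ ≤ p ∸ 1 →
    (g : ℕ) → IsFrobenius p q g →
    ((g₂ p q κ ≤ℤ + g) × (+ g ≤ℤ g₀ p q κ))
    × ((+ g ≡ g₀ p q κ) ⇔ (κ + λ′ ≥ p))
    × ((p ≡ 3 ⊎ q ≡ p + 2) → + g ≡ g₂ p q κ)
theorem2p1 p q p-prime q-prime 2<p p<q κ λ′ q≡ 1≤λ λ<p g frob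
  with prime-pair-parameters p q κ λ′ p-prime q-prime 2<p p<q q≡ λ<p
... | a′ , κ′ , e , refl , refl , refl , κ+λ = theorem-odd a′ κ′ e λ′ κ+λ 1≤λ λ<p g frob
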